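{- Let $n\ge1$ and let $F:(2^{\mathbb{N}})^n\to2^{\mathbb{N}}$ be defined by a $(\mathcal{U},\varepsilon)$-circuit. Then there exist $\vec s\in(2^{\mathbb{N}})^n$ and $m\in\mathbb{N}$ such that $F$ is uniformly continuous on the set $D=\{\vec t\in(2^{\mathbb{N}})^n\mid \vec s_{|m}=\vec t_{|m}\}$, i.e. for every $m'\in\mathbb{N}$ there is $k\in\mathbb{N}$ such that for all $\vec t,\vec t'\in D$, $\vec t_{|k}=\vec t'_{|k}$ implies $F(\vec t)_{|m'}=F(\vec t')_{|m'}$.
   Context: $\mathbb{N}=\{0,1,2,\ldots\}$, $2^{\mathbb{N}}$ is its power set. A set-function is a map $(2^{\mathbb{N}})^k\to 2^{\mathbb{N}}$ for some $k\ge 0$. For a collection $\mathcal{O}$ of set-functions, $\mathcal{O}$-circuits are terms built from variables ranging over $2^{\mathbb{N}}$, the constants $\emptyset$, $\mathbb{N}$, $\{n\}$ ($n\in\mathbb{N}$), the operations $\cup$, $\cap$, complement relative to $\mathbb{N}$, and the functions in $\mathcal{O}$; a circuit with variables $x_1,\ldots,x_n$ defines the function obtained by evaluation. A $(\mathcal{U},\varepsilon)$-circuit is a $(\mathcal{U}\cup\{\varepsilon\})$-circuit. For $s\subseteq\mathbb{N}$, $s_{|m}=s\cap\{0,\ldots,m\}$, componentwise on tuples. A set-function $G$ of arity $n$ is continuous at $\vec s$ if for every $m$ there is $n'$ such that for all $\vec t$, $\vec t_{|n'}=\vec s_{|n'}$ implies $G(\vec t)_{|m}=G(\vec s)_{|m}$;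 $\mathcal{U}$ is the collection of all set-functions (all arities) continuous everywhere. $\varepsilon(x)=\{0\}$ if $x=\emptyset$ and $\varepsilon(x)=\emptyset$ otherwise. -}

module Defs where

open import Level using (0ℓ)
open import Data.Nat using (ℕ; _≤_)
open import Data.Fin using (Fin)
open import Data.Product using (Σ; ∃; _×_)
open import Relation.Nullary using (¬_)
open import Relation.Binary.PropositionalEquality using (_≡_)
open import Function.Bundles using (_⇔_)
open import Data.Empty using (⊥)
open import Data.Unit using (⊤)
open import Data.Sum using (_⊎_)

SubsetN : Set₁
SubsetN = ℕ → Set

Tuple : ℕ → Set₁
Tuple n = Fin n → SubsetN

-- s_{|m} = t_{|m}, where s_{|m} = s ∩ {0,…,m}
_≈[_]_ : SubsetN → ℕ → SubsetN → Set
s ≈[ m ] t = ∀ i → i ≤ m → (s i ⇔ t i)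

_≈⃗[_]_ : ∀ {n} → Tuple n → ℕ → Tuple n → Set
s ≈⃗[ m ] t = ∀ j → s j ≈[ m ] t j

SetFun : ℕ → Set₁
SetFun k = Tuple k → SubsetN

ContinuousAt : ∀ {k} → SetFun k → Tuple k → Set₁
ContinuousAt G s = ∀ m → ∃ λ n' → ∀ t → t ≈⃗[ n' ] s → G t ≈[ m ] G s

-- elements of 𝒰: set-functions (of any arity) continuous everywhere
record UFun : Set₁ where
  field
    arity      : ℕ
    fun        : SetFun arity
    continuous : ∀ s → ContinuousAt fun s

data Circuit (n : ℕ) : Set₁ where
  var    : Fin n → Circuit n
  empty  : Circuit n
  full   : Circuit n
  single : ℕ → Circuit n
  _∪c_   : Circuit n → Circuit n → Circuit n
  _∩c_   : Circuit n → Circuit n → Circuit n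
  compl  : Circuit n → Circuit n
  app    : (f : UFun) → (Fin (UFun.arity f) → Circuit n) → Circuit n
  eps    : Circuit n → Circuit n

ε : SubsetN → SubsetN
ε x i = (i ≡ 0) × (∀ j → ¬ x j)

⟦_⟧ : ∀ {n} → Circuit n → Tuple n → SubsetN
⟦ var j ⟧ ρ i = ρ j i
⟦ empty ⟧ ρ i = ⊥
⟦ full ⟧ ρ i = ⊤
⟦ single a ⟧ ρ i = i ≡ a
⟦ c ∪c d ⟧ ρ i = ⟦ c ⟧ ρ i ⊎ ⟦ d ⟧ ρ i
⟦ c ∩c d ⟧ ρ i = ⟦ c ⟧ ρ i × ⟦ d ⟧ ρ i
⟦ compl c ⟧ ρ i = ¬ ⟦ c ⟧ ρ i
⟦ app f cs ⟧ ρ = UFun.fun f (λ j → ⟦ cs j ⟧ ρ)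
⟦ eps c ⟧ ρ = ε (⟦ c ⟧ ρ)

module Submission where

-- Proof idea.  Call the tuples t with s ≈⃗[ m ] t a cylinder; G is continuous
-- on it if G is continuous at each of its points relative to the cylinder.
-- The proof has two independent halves.
--
--  1. Density.  For every circuit C, every cylinder contains a sub-cylinder on
--     which ⟦ C ⟧ is continuous.  Variables, constants, ∪, ∩, complement and
--     functions from 𝒰 preserve continuity on a fixed cylinder, so one only has
--     to shrink the cylinder finitely often for the arguments.  The
--     discontinuous gate ε is handled classically: either the argument is
--     empty on the whole cylinder (so ε is constantly {0} there), or it
--     contains some i at some point, and then, by continuity, on a whole
--     smaller cylinder around that point (so ε is constantly ∅ there).
--  2. Fan theorem.  Continuity on a cylinder implies uniform continuity on it:
--     a counterexample sequence has a cluster point inside the cylinder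
--     (König's lemma, via an infinite pigeonhole principle), and continuity
--     at the cluster point contradicts the sequence.
--
-- Both halves are classical; since tuples live in Set₁, the classical
-- arguments quantify over Bool-valued points, which represent every tuple up
-- to extensional equality.

open import Defs
open import Level using (0ℓ)
open import Axiom.ExcludedMiddle using (ExcludedMiddle)
open import Data.Nat using (ℕ; _≤_; _<_; zero; suc; _⊔_; s≤s)
open import Data.Nat.Properties using (≤-refl; ≤-trans; m≤m⊔n; m≤n⊔m; m≤n⇒m<n∨m≡n)
open import Data.Product using (∃; ∃₂; Σ; _×_; _,_; proj₁; proj₂)
open import Data.Product.Function.NonDependent.Propositional using (_×-⇔_)
open import Data.Sum using (_⊎_; inj₁; inj₂)
open import Data.Sum.Function.Propositional using (_⊎-⇔_)
open import Data.Fin using (Fin; zero; suc)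
open import Data.Bool using (Bool; true; false; T)
open import Data.Bool.Properties using (¬-not)
open import Data.Vec.Functional using (_∷_)
open import Data.Empty using (⊥; ⊥-elim)
open import Data.Unit using (⊤; tt)
open import Relation.Nullary using (¬_; yes; no; does)
open import Relation.Binary.PropositionalEquality using (_≡_; refl)
open import Relation.Binary.Structures using (IsEquivalence)
open import Function.Bundles using (_⇔_; mk⇔; Equivalence)
open import Function.Properties.Equivalence using (⇔-isEquivalence)
open import Function.Construct.Identity using (⇔-id)
open import Function.Construct.Symmetry using (⇔-sym)
open import Function.Related.TypeIsomorphisms using (¬-cong-⇔)

open Equivalence using (to; from)
open IsEquivalence (⇔-isEquivalence {0ℓ}) using () renaming (trans to ⇔-trans)

≈⃗-sym : ∀ {n m} {s t : Tuple n} → s ≈⃗[ m ] t → t ≈⃗[ m ] s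
≈⃗-sym s≈t j i i≤m = ⇔-sym (s≈t j i i≤m)

≈⃗-trans : ∀ {n m} {s t u : Tuple n} → s ≈⃗[ m ] t → t ≈⃗[ m ] u → s ≈⃗[ m ] u
≈⃗-trans s≈t t≈u j i i≤m = ⇔-trans (s≈t j i i≤m) (t≈u j i i≤m)

≈⃗-mono : ∀ {n m m'} {s t : Tuple n} → m ≤ m' → s ≈⃗[ m' ] t → s ≈⃗[ m ] t
≈⃗-mono m≤m' s≈t j i i≤m = s≈t j i (≤-trans i≤m m≤m')

_≐_ : ∀ {n} → Tuple n → Tuple n → Set
t ≐ t' = ∀ j i → t j i ⇔ t' j i

≐⇒≈⃗ : ∀ {n m} {t t' : Tuple n} → t ≐ t' → t ≈⃗[ m ] t'
≐⇒≈⃗ t≐t' j i _ = t≐t' j i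

Extensional : ∀ {n} → (Tuple n → SubsetN) → Set₁
Extensional G = ∀ {t t'} → t ≐ t' → ∀ i → G t i ⇔ G t' i

ε-of-inhabited : ∀ {x : SubsetN} {i} → x i → ∀ j → ¬ ε x j
ε-of-inhabited i∈x j (_ , x-empty) = x-empty _ i∈x

ε-of-empty : ∀ {x : SubsetN} → (∀ i → ¬ x i) → ∀ j → ε x j ⇔ (j ≡ 0)
ε-of-empty x-empty j = mk⇔ proj₁ (λ j≡0 → j≡0 , x-empty)

ε-cong : ∀ {x y : SubsetN} → (∀ i → x i ⇔ y i) → ∀ j → ε x j ⇔ ε y j
ε-cong x⇔y j = ⇔-id _ ×-⇔ mk⇔ (λ x-empty i yi → x-empty i (from (x⇔y i) yi))
                               (λ y-empty i xi → y-empty i (to (x⇔y i) xi))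

-- Circuits define extensional functions; for gates from 𝒰 this is a
-- consequence of their continuity.
⟦⟧-extensional : ∀ {n} (C : Circuit n) → Extensional ⟦ C ⟧
⟦⟧-extensional (var j) t≐t' i = t≐t' j i
⟦⟧-extensional empty t≐t' i = ⇔-id _
⟦⟧-extensional full t≐t' i = ⇔-id _
⟦⟧-extensional (single a) t≐t' i = ⇔-id _
⟦⟧-extensional (c ∪c d) t≐t' i = ⟦⟧-extensional c t≐t' i ⊎-⇔ ⟦⟧-extensional d t≐t' i
⟦⟧-extensional (c ∩c d) t≐t' i = ⟦⟧-extensional c t≐t' i ×-⇔ ⟦⟧-extensional d t≐t' i
⟦⟧-extensional (compl c) t≐t' i = ¬-cong-⇔ (⟦⟧-extensional c t≐t' i)
⟦⟧-extensional (app f cs) {t' = t'} t≐t' i =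
  let (_ , modulus) = UFun.continuous f (λ j → ⟦ cs j ⟧ t') i
  in modulus _ (≐⇒≈⃗ λ j → ⟦⟧-extensional (cs j) t≐t') i ≤-refl
⟦⟧-extensional (eps c) t≐t' = ε-cong (⟦⟧-extensional c t≐t')

ContinuousOn : ∀ {n} → (Tuple n → SubsetN) → Tuple n → ℕ → Set₁
ContinuousOn G s m =
  ∀ x → s ≈⃗[ m ] x → ∀ m' → ∃ λ N →
    ∀ t → s ≈⃗[ m ] t → t ≈⃗[ N ] x → G t ≈[ m' ] G x

UniformlyContinuousOn : ∀ {n} → (Tuple n → SubsetN) → Tuple n → ℕ → Set₁
UniformlyContinuousOn G s m =
  ∀ m' → ∃ λ k →
    ∀ t t' → s ≈⃗[ m ] t → s ≈⃗[ m ] t' → t ≈⃗[ k ] t' → G t ≈[ m' ] G t'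

SubCylinder : ∀ {n} → Tuple n → ℕ → Tuple n → ℕ → Set₁
SubCylinder s' m' s m = ∀ t → s' ≈⃗[ m' ] t → s ≈⃗[ m ] t

ConstantOn : ∀ {n} → (Tuple n → SubsetN) → Tuple n → ℕ → Set₁
ConstantOn G s m = ∀ t t' → s ≈⃗[ m ] t → s ≈⃗[ m ] t' → ∀ i → G t i ⇔ G t' i

continuousOn-sub : ∀ {n} {G : Tuple n → SubsetN} {s s' m m'} →
  ContinuousOn G s m → SubCylinder s' m' s m → ContinuousOn G s' m'
continuousOn-sub cont sub x x∈ m' =
  let (N , near) = cont x (sub x x∈) m'
  in N , λ t t∈ → near t (sub t t∈)

constantOn⇒continuousOn : ∀ {n} {G : Tuple n → SubsetN} {s m} →
  ConstantOn G s m → ContinuousOn G s m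
constantOn⇒continuousOn const x x∈ m' = 0 , λ t t∈ _ i _ → const t x t∈ x∈ i

continuousOn-var : ∀ {n} (j : Fin n) {s m} → ContinuousOn (λ t → t j) s m
continuousOn-var j x x∈ m' = m' , λ t t∈ t≈x → t≈x j

continuousOn-combine : ∀ {n} (op : Set → Set → Set) →
  (∀ {A B A' B'} → A ⇔ A' → B ⇔ B' → op A B ⇔ op A' B') →
  ∀ {F G : Tuple n → SubsetN} {s m} → ContinuousOn F s m → ContinuousOn G s m →
  ContinuousOn (λ t i → op (F t i) (G t i)) s m
continuousOn-combine op op-cong contF contG x x∈ m' =
  let (N₁ , nearF) = contF x x∈ m'
      (N₂ , nearG) = contG x x∈ m'
  in N₁ ⊔ N₂ , λ t t∈ t≈x i i≤m' →
       op-cong (nearF t t∈ (≈⃗-mono (m≤m⊔n N₁ N₂) t≈x) i i≤m')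
               (nearG t t∈ (≈⃗-mono (m≤n⊔m N₁ N₂) t≈x) i i≤m')

continuousOn-¬ : ∀ {n} {F : Tuple n → SubsetN} {s m} →
  ContinuousOn F s m → ContinuousOn (λ t i → ¬ F t i) s m
continuousOn-¬ contF x x∈ m' =
  let (N , near) = contF x x∈ m'
  in N , λ t t∈ t≈x i i≤m' → ¬-cong-⇔ (near t t∈ t≈x i i≤m')

bound : ∀ {a} → (Fin a → ℕ) → ℕ
bound {zero} f = 0
bound {suc a} f = f zero ⊔ bound (λ j → f (suc j))

≤-bound : ∀ {a} (f : Fin a → ℕ) j → f j ≤ bound f
≤-bound f zero = m≤m⊔n (f zero) _
≤-bound f (suc j) = ≤-trans (≤-bound (λ j → f (suc j)) j) (m≤n⊔m (f zero) _)

-- A function from 𝒰 applied to continuous arguments is continuous: take the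
-- largest of the moduli the arguments need for the modulus of f.
continuousOn-app : ∀ {n} (f : UFun) (Gs : Fin (UFun.arity f) → Tuple n → SubsetN) {s m} →
  (∀ j → ContinuousOn (Gs j) s m) → ContinuousOn (λ t → UFun.fun f (λ j → Gs j t)) s m
continuousOn-app f Gs conts x x∈ m' =
  let (n' , near-f) = UFun.continuous f (λ j → Gs j x) m'
      modulus = λ j → proj₁ (conts j x x∈ n')
  in bound modulus , λ t t∈ t≈x →
       near-f (λ j → Gs j t)
              (λ j → proj₂ (conts j x x∈ n') t t∈ (≈⃗-mono (≤-bound modulus j) t≈x))

DenselyContinuous : ∀ {n} → (Tuple n → SubsetN) → Set₁
DenselyContinuous G =
  ∀ s m → ∃₂ λ s' m' → SubCylinder s' m' s m × ContinuousOn G s' m'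

-- Finitely many densely continuous functions are simultaneously continuous on
-- a sub-cylinder of any cylinder: shrink the cylinder once for each of them.
jointly-continuous : ∀ {n a} (Gs : Fin a → Tuple n → SubsetN) →
  (∀ j → DenselyContinuous (Gs j)) →
  ∀ s m → ∃₂ λ s' m' → SubCylinder s' m' s m × (∀ j → ContinuousOn (Gs j) s' m')
jointly-continuous {a = zero} Gs dense s m = s , m , (λ t t∈ → t∈) , λ ()
jointly-continuous {a = suc a} Gs dense s m =
  let (s₁ , m₁ , sub₁ , cont₁) = dense zero s m
      (s₂ , m₂ , sub₂ , conts) = jointly-continuous (λ j → Gs (suc j)) (λ j → dense (suc j)) s₁ m₁
  in s₂ , m₂ , (λ t t∈ → sub₁ t (sub₂ t t∈)) ,
     λ { zero → continuousOn-sub cont₁ sub₂ ; (suc j) → conts j }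

dense-closure : ∀ {n a} (Gs : Fin a → Tuple n → SubsetN) {H : Tuple n → SubsetN} →
  (∀ j → DenselyContinuous (Gs j)) →
  (∀ {s m} → (∀ j → ContinuousOn (Gs j) s m) → ContinuousOn H s m) →
  DenselyContinuous H
dense-closure Gs dense preserve s m =
  let (s' , m' , sub , conts) = jointly-continuous Gs dense s m
  in s' , m' , sub , preserve conts

everywhere⇒dense : ∀ {n} {H : Tuple n → SubsetN} →
  (∀ {s m} → ContinuousOn H s m) → DenselyContinuous H
everywhere⇒dense cont = dense-closure {a = 0} (λ ()) (λ ()) (λ _ → cont)

dense-closure₁ : ∀ {n} {F H : Tuple n → SubsetN} → DenselyContinuous F →
  (∀ {s m} → ContinuousOn F s m → ContinuousOn H s m) → DenselyContinuous H
dense-closure₁ {F = F} denseF preserve =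
  dense-closure {a = 1} (λ _ → F) (λ _ → denseF) (λ conts → preserve (conts zero))

dense-closure₂ : ∀ {n} {F G H : Tuple n → SubsetN} →
  DenselyContinuous F → DenselyContinuous G →
  (∀ {s m} → ContinuousOn F s m → ContinuousOn G s m → ContinuousOn H s m) →
  DenselyContinuous H
dense-closure₂ {F = F} {G} denseF denseG preserve =
  dense-closure {a = 2} (λ { zero → F ; (suc zero) → G })
                (λ { zero → denseF ; (suc zero) → denseG })
                (λ conts → preserve (conts zero) (conts (suc zero)))

module Classical (lem : ExcludedMiddle 0ℓ) where

  dne : {P : Set} → ¬ ¬ P → P
  dne {P} ¬¬p with lem {P}
  ... | yes p = p
  ... | no ¬p = ⊥-elim (¬¬p ¬p)

  ≡⇒T⇔ : ∀ {u v} → u ≡ v → T u ⇔ T v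
  ≡⇒T⇔ refl = ⇔-id _

  -- Bool-valued points; unlike tuples they form a small type, so excluded
  -- middle applies to statements quantifying over them.
  Point : ℕ → Set
  Point n = Fin n → ℕ → Bool

  ⟪_⟫ : ∀ {n} → Point n → Tuple n
  ⟪ b ⟫ j i = T (b j i)

  decide : ∀ {n} → Tuple n → Point n
  decide t j i = does (lem {t j i})

  decide-≐ : ∀ {n} (t : Tuple n) → t ≐ ⟪ decide t ⟫
  decide-≐ t j i with lem {t j i}
  ... | yes tji = mk⇔ (λ _ → tt) (λ _ → tji)
  ... | no ¬tji = mk⇔ ¬tji ⊥-elim

  dense-ε : ∀ {n} {G : Tuple n → SubsetN} → Extensional G →
    DenselyContinuous G → DenselyContinuous (λ t → ε (G t))
  dense-ε {n} {G} ext dense s m with dense s m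
  ... | s₁ , m₁ , sub₁ , cont₁ with lem {∃₂ λ (b : Point n) i → s₁ ≈⃗[ m₁ ] ⟪ b ⟫ × G ⟪ b ⟫ i}
  ... | yes (b , i , b∈ , i∈Gb) =
    let (N , near) = cont₁ ⟪ b ⟫ b∈ i
        inside : SubCylinder ⟪ b ⟫ (m₁ ⊔ N) s₁ m₁
        inside t t∈ = ≈⃗-trans b∈ (≈⃗-mono (m≤m⊔n m₁ N) t∈)
        i∈G : ∀ t → ⟪ b ⟫ ≈⃗[ m₁ ⊔ N ] t → G t i
        i∈G t t∈ = from (near t (inside t t∈) (≈⃗-sym (≈⃗-mono (m≤n⊔m m₁ N) t∈)) i ≤-refl) i∈Gb
    in ⟪ b ⟫ , m₁ ⊔ N , (λ t t∈ → sub₁ t (inside t t∈)) ,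
       constantOn⇒continuousOn λ t t' t∈ t'∈ j →
         mk⇔ (λ e → ⊥-elim (ε-of-inhabited (i∈G t t∈) j e))
             (λ e → ⊥-elim (ε-of-inhabited (i∈G t' t'∈) j e))
  ... | no no-witness =
    let
        G-empty : ∀ t → s₁ ≈⃗[ m₁ ] t → ∀ i → ¬ G t i
        G-empty t t∈ i i∈Gt =
          no-witness (decide t , i , ≈⃗-trans t∈ (≐⇒≈⃗ (decide-≐ t)) ,
                      to (ext (decide-≐ t) i) i∈Gt)
    in s₁ , m₁ , sub₁ ,
       constantOn⇒continuousOn λ t t' t∈ t'∈ j →
         ⇔-trans (ε-of-empty (G-empty t t∈) j) (⇔-sym (ε-of-empty (G-empty t' t'∈) j))

  circuit-dense : ∀ {n} (C : Circuit n) → DenselyContinuous ⟦ C ⟧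
  circuit-dense (var j) = everywhere⇒dense (continuousOn-var j)
  circuit-dense empty = everywhere⇒dense (constantOn⇒continuousOn λ _ _ _ _ _ → ⇔-id _)
  circuit-dense full = everywhere⇒dense (constantOn⇒continuousOn λ _ _ _ _ _ → ⇔-id _)
  circuit-dense (single a) = everywhere⇒dense (constantOn⇒continuousOn λ _ _ _ _ _ → ⇔-id _)
  circuit-dense (c ∪c d) =
    dense-closure₂ (circuit-dense c) (circuit-dense d) (continuousOn-combine _⊎_ _⊎-⇔_)
  circuit-dense (c ∩c d) =
    dense-closure₂ (circuit-dense c) (circuit-dense d) (continuousOn-combine _×_ _×-⇔_)
  circuit-dense (compl c) = dense-closure₁ (circuit-dense c) continuousOn-¬
  circuit-dense (app f cs) =
    dense-closure (λ j → ⟦ cs j ⟧) (λ j → circuit-dense (cs j)) (continuousOn-app f _)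
  circuit-dense (eps c) = dense-ε (⟦⟧-extensional c) (circuit-dense c)

  Infinite : (ℕ → Set) → Set
  Infinite Q = ∀ a → ∃ λ k → a ≤ k × Q k

  infinite-split : (Q : ℕ → Set) (g : ℕ → Bool) → Infinite Q →
    ∃ λ v → Infinite (λ k → Q k × g k ≡ v)
  infinite-split Q g inf with lem {Infinite (λ k → Q k × g k ≡ true)}
  ... | yes inf-true = true , inf-true
  ... | no fin-true = false , inf-false
    where
      threshold : ∃ λ a₀ → ∀ k → a₀ ≤ k → Q k → ¬ g k ≡ true
      threshold = dne λ no-threshold → fin-true λ a → dne λ none →
        no-threshold (a , λ k a≤k qk gk → none (k , a≤k , qk , gk))

      inf-false : Infinite (λ k → Q k × g k ≡ false)
      inf-false a =
        let (a₀ , no-true) = threshold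
            (k , a⊔a₀≤k , qk) = inf (a ⊔ a₀)
        in k , ≤-trans (m≤m⊔n a a₀) a⊔a₀≤k , qk ,
           ¬-not (no-true k (≤-trans (m≤n⊔m a a₀) a⊔a₀≤k) qk)

  infinite-split-vec : ∀ n (Q : ℕ → Set) (f : ℕ → Fin n → Bool) → Infinite Q →
    ∃ λ (v : Fin n → Bool) → Infinite (λ k → Q k × (∀ c → f k c ≡ v c))
  infinite-split-vec zero Q f inf =
    (λ ()) , λ a → let (k , a≤k , qk) = inf a in k , a≤k , qk , λ ()
  infinite-split-vec (suc n) Q f inf =
    let (v₀ , inf₀) = infinite-split Q (λ k → f k zero) inf
        (v , inf-rest) = infinite-split-vec n (λ k → Q k × f k zero ≡ v₀)
                                           (λ k c → f k (suc c)) inf₀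
    in v₀ ∷ v , λ a →
         let (k , a≤k , (qk , e₀) , es) = inf-rest a
         in k , a≤k , qk , λ { zero → e₀ ; (suc c) → es c }

  -- The i-th column
  -- of x is chosen so that infinitely many of the terms chosen so far agree
  -- with it there.
  cluster-point : ∀ {n} (seq : ℕ → Point n) →
    ∃ λ (x : Point n) → ∀ N → Infinite (λ k → ⟪ seq k ⟫ ≈⃗[ N ] ⟪ x ⟫)
  cluster-point {n} seq = limit , clusters
    where
      Stage : Set₁
      Stage = Σ (ℕ → Set) Infinite

      column : (st : Stage) (i : ℕ) →
        ∃ λ (v : Fin n → Bool) → Infinite (λ k → proj₁ st k × (∀ c → seq k c i ≡ v c))
      column (Q , inf) i = infinite-split-vec n Q (λ k c → seq k c i) inf

      -- the infinite set of indices of terms agreeing with limit on columns < i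
      stage : ℕ → Stage
      stage zero = (λ _ → ⊤) , λ a → a , ≤-refl , tt
      stage (suc i) = (λ k → proj₁ (stage i) k × (∀ c → seq k c i ≡ proj₁ (column (stage i) i) c)) ,
                      proj₂ (column (stage i) i)

      limit : Point n
      limit c i = proj₁ (column (stage i) i) c

      agrees : ∀ i k → proj₁ (stage i) k → ∀ c i' → i' < i → seq k c i' ≡ limit c i'
      agrees (suc i) k (k∈ , eq) c i' (s≤s i'≤i) with m≤n⇒m<n∨m≡n i'≤i
      ... | inj₁ i'<i = agrees i k k∈ c i' i'<i
      ... | inj₂ refl = eq c

      clusters : ∀ N → Infinite (λ k → ⟪ seq k ⟫ ≈⃗[ N ] ⟪ limit ⟫)
      clusters N a =
        let (k , a≤k , k∈) = proj₂ (stage (suc N)) a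
        in k , a≤k , λ c i i≤N → ≡⇒T⇔ (agrees (suc N) k k∈ c i (s≤s i≤N))

  module FanTheorem {n} {G : Tuple n → SubsetN} (ext : Extensional G)
                    {s : Tuple n} {m : ℕ} (cont : ContinuousOn G s m) (m' : ℕ) where

    UniformOnPoints : ℕ → Set
    UniformOnPoints k = ∀ (b b' : Point n) → s ≈⃗[ m ] ⟪ b ⟫ → s ≈⃗[ m ] ⟪ b' ⟫ →
                        ⟪ b ⟫ ≈⃗[ k ] ⟪ b' ⟫ → G ⟪ b ⟫ ≈[ m' ] G ⟪ b' ⟫

    uniform-from-points : ∀ {k} → UniformOnPoints k →
      ∀ t t' → s ≈⃗[ m ] t → s ≈⃗[ m ] t' → t ≈⃗[ k ] t' → G t ≈[ m' ] G t'
    uniform-from-points uniform t t' t∈ t'∈ t≈t' i i≤m' =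
      ⇔-trans (ext (decide-≐ t) i)
        (⇔-trans (uniform (decide t) (decide t')
                    (≈⃗-trans t∈ (≐⇒≈⃗ (decide-≐ t))) (≈⃗-trans t'∈ (≐⇒≈⃗ (decide-≐ t')))
                    (≈⃗-trans (≐⇒≈⃗ (λ j i → ⇔-sym (decide-≐ t j i)))
                              (≈⃗-trans t≈t' (≐⇒≈⃗ (decide-≐ t')))) i i≤m')
                 (⇔-sym (ext (decide-≐ t') i)))

    record BadPair (k : ℕ) : Set where
      field
        left right : Point n
        left∈      : s ≈⃗[ m ] ⟪ left ⟫
        right∈     : s ≈⃗[ m ] ⟪ right ⟫
        close      : ⟪ left ⟫ ≈⃗[ k ] ⟪ right ⟫
        apart      : ¬ (G ⟪ left ⟫ ≈[ m' ] G ⟪ right ⟫)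

    -- bad pairs cannot exist for all k: their left points cluster at some x
    -- in the cylinder, and continuity at x bounds the distance of G-values
    -- for pairs close enough to x
    no-bad-sequence : ¬ (∀ k → BadPair k)
    no-bad-sequence bad =
      let (x , clusters) = cluster-point (λ k → BadPair.left (bad k))
          x∈ = let (k , _ , left≈x) = clusters m 0 in ≈⃗-trans (BadPair.left∈ (bad k)) left≈x
          (N , near) = cont ⟪ x ⟫ x∈ m'
          (k , N≤k , left≈x) = clusters N N
          open BadPair (bad k)
          right≈x = ≈⃗-trans (≈⃗-sym (≈⃗-mono N≤k close)) left≈x
      in apart λ i i≤m' → ⇔-trans (near ⟪ left ⟫ left∈ left≈x i i≤m')
                                  (⇔-sym (near ⟪ right ⟫ right∈ right≈x i i≤m'))

    fan : ∃ λ k → ∀ t t' → s ≈⃗[ m ] t → s ≈⃗[ m ] t' → t ≈⃗[ k ] t' → G t ≈[ m' ] G t'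
    fan with lem {∃ UniformOnPoints}
    ... | yes (k , uniform) = k , uniform-from-points uniform
    ... | no no-modulus = ⊥-elim (no-bad-sequence λ k → dne λ ¬bad →
            no-modulus (k , λ b b' b∈ b'∈ close → dne λ apart →
              ¬bad (record { left = b ; right = b' ; left∈ = b∈ ; right∈ = b'∈
                           ; close = close ; apart = apart })))

  fan-theorem : ∀ {n} {G : Tuple n → SubsetN} {s m} → Extensional G →
    ContinuousOn G s m → UniformlyContinuousOn G s m
  fan-theorem ext cont m' = FanTheorem.fan ext cont m'

theorem6 : ExcludedMiddle 0ℓ →
    ∀ (n : ℕ) → 1 ≤ n → (C : Circuit n) →
    ∃₂ λ (s : Tuple n) (m : ℕ) →
    ∀ (m' : ℕ) → ∃ λ (k : ℕ) →
    ∀ (t t' : Tuple n) → s ≈⃗[ m ] t → s ≈⃗[ m ] t' →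
    t ≈⃗[ k ] t' → ⟦ C ⟧ t ≈[ m' ] ⟦ C ⟧ t'
theorem6 lem _ _ C =
  let (s , m , _ , cont) = circuit-dense C (λ _ _ → ⊥) 0
  in s , m , fan-theorem (⟦⟧-extensional C) cont
  where open Classical lem
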